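{- Let $k\geq 2$ be an integer. The sequence $\left(2^{n-2}-F_n^{(k)}\right)_{n}$ is strictly increasing for $n\geq k+3$; that is, for every integer $n\ge k+3$, $$2^{n-1}-F_{n+1}^{(k)}>2^{n-2}-F_n^{(k)}.$$
   Context: For an integer $k\geq 2$, the $k$-generalized Fibonacci sequence $(F_n^{(k)})_{n\geq 2-k}$ is defined by $F_{ -(k-2)}^{(k)}=\cdots=F_0^{(k)}=0$, $F_1^{(k)}=1$, and $F_n^{(k)}=F_{n-1}^{(k)}+\cdots+F_{n-k}^{(k)}$ for $n\geq 2$. -}

module Defs where

open import Data.Nat using (ℕ; zero; suc; _+_)
open import Data.List using (List; []; _∷_; take; replicate)
open import Data.Nat.ListAction using (sum)

-- The window holds the k most recent terms (most recent first):
-- kWindow k n = [F_n, F_{n-1}, ..., F_{n-k+1}], where terms with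
-- index ≤ 0 are 0 (F_{-(k-2)} = ... = F_0 = 0).
kWindow : ℕ → ℕ → List ℕ
kWindow k zero = replicate k 0
kWindow k (suc zero) = take k (1 ∷ kWindow k zero)
kWindow k (suc (suc n)) =
  let w = kWindow k (suc n) in take k (sum w ∷ w)

kFib : ℕ → ℕ → ℕ
kFib k zero = 0
kFib k (suc zero) = 1
kFib k (suc (suc n)) = sum (kWindow k (suc n))

{-# OPTIONS --safe #-}
module Submission where

-- The recurrence gives F_{n+1} = 2 F_n − F_{n−k}, so F_{n+1} − F_n = F_n − F_{n−k}.
-- Since F_{n−k} ≥ 1 once n ≥ k + 1 and F_n ≤ 2^{n−2} (each term is at most twice
-- the previous one), F_{n+1} − F_n < 2^{n−2} = 2^{n−1} − 2^{n−2}.  The argument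
-- needs only k ≥ 1 and n ≥ k + 1.

open import Defs
open import Data.Nat as ℕ using (ℕ; zero; suc; _≤_; _+_; _^_; _∸_; _⊓_; s≤s; z≤n; z<s)
open import Data.Nat.Properties
  using (≤-trans; ≤-reflexive; ≤-pred; m≤m+n; m+n≤o⇒n≤o; m<m+n; n<1+n; n≤1+n; +-assoc; +-comm;
         +-identityʳ; +-mono-≤; +-monoʳ-≤; +-monoˡ-≤; ⊓-comm; m≤n⇒m⊓n≡m; module ≤-Reasoning)
open import Data.Integer using (+_; _-_; _⊖_; _<_)
open import Data.Integer.Properties using ([+m]-[+n]≡m⊖n; +-cancelˡ-⊖; ⊖-monoˡ-<)
open import Data.List using (List; []; _∷_; take; drop; replicate; length)
open import Data.List.Properties using (take++drop≡id; take-all; take-take; length-take; length-replicate)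
open import Data.List.Relation.Unary.All using (All; []; _∷_)
open import Data.List.Relation.Unary.All.Properties using (take⁺)
open import Data.Nat.ListAction using (sum)
open import Data.Nat.ListAction.Properties using (sum-++)
open import Relation.Binary.PropositionalEquality using (_≡_; refl; sym; trans; cong; subst; subst₂; module ≡-Reasoning)

sum-take+sum-drop : ∀ n (xs : List ℕ) → sum (take n xs) + sum (drop n xs) ≡ sum xs
sum-take+sum-drop n xs = trans (sym (sum-++ (take n xs) (drop n xs))) (cong sum (take++drop≡id n xs))

sum-take≤sum : ∀ n (xs : List ℕ) → sum (take n xs) ≤ sum xs
sum-take≤sum n xs = subst (sum (take n xs) ≤_) (sum-take+sum-drop n xs) (m≤m+n _ _)

sum-replicate-zero : ∀ n → sum (replicate n 0) ≡ 0
sum-replicate-zero zero = refl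
sum-replicate-zero (suc n) = sum-replicate-zero n

1≤sum-drop : ∀ n {xs : List ℕ} → All (1 ≤_) xs → n ℕ.< length xs → 1 ≤ sum (drop n xs)
1≤sum-drop zero    (p ∷ _)  _           = ≤-trans p (m≤m+n _ _)
1≤sum-drop (suc n) (_ ∷ ps) (s≤s n<len) = 1≤sum-drop n ps n<len

length-take-∷ : ∀ {n} x {xs : List ℕ} → length xs ≡ n → length (take n (x ∷ xs)) ≡ n
length-take-∷ {n} x {xs} refl =
  trans (length-take n (x ∷ xs)) (m≤n⇒m⊓n≡m (n≤1+n n))

All-take-take : ∀ {P : ℕ → Set} m n {xs : List ℕ} → All P (take m xs) → All P (take m (take n xs))
All-take-take {P} m n {xs} pxs = subst (All P) take-comm (take⁺ n pxs)
  where
  take-comm : take n (take m xs) ≡ take m (take n xs)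
  take-comm = begin
    take n (take m xs) ≡⟨ take-take n m xs ⟩
    take (n ⊓ m) xs    ≡⟨ cong (λ i → take i xs) (⊓-comm n m) ⟩
    take (m ⊓ n) xs    ≡⟨ take-take m n xs ⟨
    take m (take n xs) ∎
    where open ≡-Reasoning

module _ (j : ℕ) where

  private
    k : ℕ
    k = suc j

  -- The oldest entry F_{n−j} of the window ending at F_n; it is the term
  -- that drops out of the sum when the window slides.
  oldest : ℕ → ℕ
  oldest n = sum (drop j (kWindow k n))

  length-kWindow : ∀ n → length (kWindow k n) ≡ k
  length-kWindow zero          = length-replicate k
  length-kWindow (suc zero)    = length-take-∷ 1 (length-kWindow zero)
  length-kWindow (suc (suc n)) = length-take-∷ (kFib k (2 + n)) (length-kWindow (suc n))

  kFib-recurrence : ∀ n → kFib k (3 + n) + oldest (suc n) ≡ kFib k (2 + n) + kFib k (2 + n)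
  kFib-recurrence n = trans (+-assoc (kFib k (2 + n)) _ _)
                            (cong (λ m → kFib k (2 + n) + m) (sum-take+sum-drop j (kWindow k (suc n))))

  kFib-positive : ∀ n → 1 ≤ kFib k (suc n)
  kFib-positive zero          = s≤s z≤n
  kFib-positive (suc zero)    = m≤m+n 1 _
  kFib-positive (suc (suc n)) = ≤-trans (kFib-positive (suc n)) (m≤m+n _ _)

  kFib-≤-2^ : ∀ n → kFib k (2 + n) ≤ 2 ^ n
  kFib-≤-2^ zero = ≤-trans (sum-take≤sum k (1 ∷ kWindow k 0))
                           (≤-reflexive (cong suc (sum-replicate-zero k)))
  kFib-≤-2^ (suc n) = begin
    kFib k (3 + n)                   ≤⟨ m≤m+n _ (oldest (suc n)) ⟩
    kFib k (3 + n) + oldest (suc n)  ≡⟨ kFib-recurrence n ⟩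
    kFib k (2 + n) + kFib k (2 + n)  ≤⟨ +-mono-≤ (kFib-≤-2^ n) (kFib-≤-2^ n) ⟩
    2 ^ n + 2 ^ n                    ≡⟨ cong (λ m → 2 ^ n + m) (+-identityʳ (2 ^ n)) ⟨
    2 ^ suc n                        ∎
    where open ≤-Reasoning

  All-positive-take-kWindow : ∀ n → All (1 ≤_) (take n (kWindow k n))
  All-positive-take-kWindow zero          = []
  All-positive-take-kWindow (suc zero)    = s≤s z≤n ∷ []
  All-positive-take-kWindow (suc (suc n)) =
    All-take-take (2 + n) k (kFib-positive (suc n) ∷ All-positive-take-kWindow (suc n))

  1≤oldest : ∀ n → k ≤ n → 1 ≤ oldest n
  1≤oldest n k≤n = 1≤sum-drop j all-positive (subst (j ℕ.<_) (sym (length-kWindow n)) (n<1+n j))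
    where
    all-positive : All (1 ≤_) (kWindow k n)
    all-positive = subst (All (1 ≤_))
                         (take-all n (kWindow k n) (subst (_≤ n) (sym (length-kWindow n)) k≤n))
                         (All-positive-take-kWindow n)

  kFib-suc+2^<kFib+2^suc : ∀ n → j ≤ n → kFib k (3 + n) + 2 ^ n ℕ.< kFib k (2 + n) + 2 ^ suc n
  kFib-suc+2^<kFib+2^suc n j≤n = begin-strict
    kFib k (3 + n) + 2 ^ n                       <⟨ +-monoˡ-≤ (2 ^ n) growth ⟩
    kFib k (3 + n) + oldest (suc n) + 2 ^ n      ≡⟨ cong (_+ 2 ^ n) (kFib-recurrence n) ⟩
    kFib k (2 + n) + kFib k (2 + n) + 2 ^ n      ≡⟨ +-assoc (kFib k (2 + n)) _ _ ⟩
    kFib k (2 + n) + (kFib k (2 + n) + 2 ^ n)    ≤⟨ +-monoʳ-≤ (kFib k (2 + n)) (+-monoˡ-≤ (2 ^ n) (kFib-≤-2^ n)) ⟩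
    kFib k (2 + n) + (2 ^ n + 2 ^ n)             ≡⟨ cong (λ m → kFib k (2 + n) + (2 ^ n + m)) (+-identityʳ (2 ^ n)) ⟨
    kFib k (2 + n) + 2 ^ suc n                   ∎
    where
    open ≤-Reasoning
    growth : kFib k (3 + n) ℕ.< kFib k (3 + n) + oldest (suc n)
    growth = subst (_≤ kFib k (3 + n) + oldest (suc n)) (+-comm (kFib k (3 + n)) 1)
                   (+-monoʳ-≤ (kFib k (3 + n)) (1≤oldest (suc n) (s≤s j≤n)))

[+a]-[+b]<[+c]-[+d] : ∀ a b c d → d + a ℕ.< b + c → (+ a) - (+ b) < (+ c) - (+ d)
[+a]-[+b]<[+c]-[+d] a b c d d+a<b+c = subst₂ _<_ lhs rhs (⊖-monoˡ-< (b + d) d+a<b+c)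
  where
  open ≡-Reasoning
  lhs : (d + a) ⊖ (b + d) ≡ (+ a) - (+ b)
  lhs = begin
    (d + a) ⊖ (b + d) ≡⟨ cong ((d + a) ⊖_) (+-comm b d) ⟩
    (d + a) ⊖ (d + b) ≡⟨ +-cancelˡ-⊖ d a b ⟩
    a ⊖ b             ≡⟨ [+m]-[+n]≡m⊖n a b ⟨
    (+ a) - (+ b)     ∎
  rhs : (b + c) ⊖ (b + d) ≡ (+ c) - (+ d)
  rhs = trans (+-cancelˡ-⊖ b c d) (sym ([+m]-[+n]≡m⊖n c d))

lemma7 : (k n : ℕ) → 2 ≤ k → k + 3 ≤ n →
    (+ (2 ^ (n ∸ 2))) - (+ kFib k n) < (+ (2 ^ (n ∸ 1))) - (+ kFib k (n + 1))
lemma7 (suc j) (suc zero) _ (s≤s j+3≤0) with m+n≤o⇒n≤o j j+3≤0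
... | ()
lemma7 (suc j) (suc (suc m)) _ (s≤s j+3≤m+1) =
  subst (λ i → (+ (2 ^ m)) - (+ kFib (suc j) (2 + m)) < (+ (2 ^ suc m)) - (+ kFib (suc j) (2 + i)))
        (+-comm 1 m)
        ([+a]-[+b]<[+c]-[+d] (2 ^ m) (kFib (suc j) (2 + m)) (2 ^ suc m) (kFib (suc j) (3 + m))
                             (kFib-suc+2^<kFib+2^suc j m j≤m))
  where
  j≤m : j ≤ m
  j≤m = ≤-pred (≤-trans (m<m+n j z<s) j+3≤m+1)
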